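{- Let $I\subseteq\{0,\dots,d\}$ with $d\notin I$, and let $I+1=\{i+1:i\in I\}$. Then $$\Diamond^d(\Gamma^d_I)=\rho(\Diamond^d(\Gamma^d_{I+1}))\cup\sigma(\Diamond^d(\Gamma^d_{I+1})),\qquad \rho(\Diamond^d(\Gamma^d_{I+1}))\cap\sigma(\Diamond^d(\Gamma^d_{I+1}))=\Diamond^{d-1}(\Gamma^{d-1}_I).$$ Moreover, $\rho(\Diamond^d(\Gamma^d_{I+1}))$ and $\sigma(\Diamond^d(\Gamma^d_{I+1}))$ are induced subcomplexes of $\Diamond^d(\Gamma^d_I)$.
   Context: For $n\ge0$, $\sigma^{n+1}$ is the simplex on $\{0,\dots,n+1\}$, $\Gamma^n_i=\{0,\dots,n+1\}\setminus\{i\}$, $\Gamma^n_I$ the subcomplex of $\partial\sigma^{n+1}$ generated by $\{\Gamma^n_i:i\in I\}$. $\Diamond^n(\Gamma)$: for $i=0,\dots,n$ in order, if $F_i=\{i+1,\dots,n+1\}$ is a face of the current complex $K$, replace $K$ by $(K\setminus F_i)\cup(\langle v_i\rangle*\partial F_i*\mathrm{lk}_K(F_i))$ with new vertex $v_i$; so $\Diamond^n(\Gamma)$ has vertices among $\{0,\dots,n\}\cup\{v_0,\dots,v_n\}$. The map $\rho$ on $\{0,\dots,d\}\cup\{v_0,\dots,v_d\}$ sends $i\mapsto i-1$ and $v_i\mapsto v_{i-1}$ with indices modulo $d+1$ (so $0\mapsto d$, $v_0\mapsto v_d$); $\psi$ interchanges $d$ and $v_d$ and fixes all other vertices; $\sigma=\psi\circ\rho$.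 Images of complexes under these maps are taken vertexwise. -}

module Defs where

open import Data.Bool using (Bool; true; false; _∧_; _∨_; not; if_then_else_)
open import Data.Nat using (ℕ; zero; suc; _+_; _≡ᵇ_; _≤ᵇ_; _%_)
open import Data.Fin using (Fin; toℕ)
import Data.Fin as Fin
open import Data.Vec using (Vec; lookup; tabulate)
open import Data.Sum using (_⊎_; inj₁; inj₂)
open import Data.Product using (Σ; _×_; _,_)
open import Relation.Binary.PropositionalEquality using (_≡_)

anyFin : ∀ {m} → (Fin m → Bool) → Bool
anyFin {zero}  p = false
anyFin {suc m} p = p Fin.zero ∨ anyFin (λ i → p (Fin.suc i))

allFin : ∀ {m} → (Fin m → Bool) → Bool
allFin {zero}  p = true
allFin {suc m} p = p Fin.zero ∧ allFin (λ i → p (Fin.suc i))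

-- Vertices and faces.
-- Ambient vertex set with parameter m: original vertices 0,…,m-1
-- (inj₁ j) and new vertices v_0,…,v_{m-1} (inj₂ j).

V : ℕ → Set
V m = Fin m ⊎ Fin m

-- A face is a finite set of vertices: (set of original vertices, set of new vertices).
Face : ℕ → Set
Face m = Vec Bool m × Vec Bool m

_∈ᵇ_ : ∀ {m} → V m → Face m → Bool
inj₁ j ∈ᵇ (A , B) = lookup A j
inj₂ j ∈ᵇ (A , B) = lookup B j

_∈F_ : ∀ {m} → V m → Face m → Set
v ∈F G = (v ∈ᵇ G) ≡ true

mkFace : ∀ {m} → (Fin m → Bool) → (Fin m → Bool) → Face m
mkFace p q = tabulate p , tabulate q

_∪F_ : ∀ {m} → Face m → Face m → Face m
F ∪F G = mkFace (λ j → (inj₁ j ∈ᵇ F) ∨ (inj₁ j ∈ᵇ G)) (λ j → (inj₂ j ∈ᵇ F) ∨ (inj₂ j ∈ᵇ G))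

_∩F_ : ∀ {m} → Face m → Face m → Face m
F ∩F G = mkFace (λ j → (inj₁ j ∈ᵇ F) ∧ (inj₁ j ∈ᵇ G)) (λ j → (inj₂ j ∈ᵇ F) ∧ (inj₂ j ∈ᵇ G))

_∖F_ : ∀ {m} → Face m → Face m → Face m
F ∖F G = mkFace (λ j → (inj₁ j ∈ᵇ F) ∧ not (inj₁ j ∈ᵇ G)) (λ j → (inj₂ j ∈ᵇ F) ∧ not (inj₂ j ∈ᵇ G))

_⊆ᵇ_ : ∀ {m} → Face m → Face m → Bool
F ⊆ᵇ G = allFin (λ j → not (inj₁ j ∈ᵇ F) ∨ (inj₁ j ∈ᵇ G))
       ∧ allFin (λ j → not (inj₂ j ∈ᵇ F) ∨ (inj₂ j ∈ᵇ G))

disjointᵇ : ∀ {m} → Face m → Face m → Bool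
disjointᵇ F G = allFin (λ j → not ((inj₁ j ∈ᵇ F) ∧ (inj₁ j ∈ᵇ G)))
              ∧ allFin (λ j → not ((inj₂ j ∈ᵇ F) ∧ (inj₂ j ∈ᵇ G)))

singleton : ∀ {m} → V m → Face m
singleton (inj₁ i) = mkFace (λ j → toℕ j ≡ᵇ toℕ i) (λ _ → false)
singleton (inj₂ i) = mkFace (λ _ → false) (λ j → toℕ j ≡ᵇ toℕ i)

-- Simplicial complexes: a (decidable) set of faces.  A complex is
-- identified with its set of faces (the empty face included whenever the
-- complex is non-void).

Complex : ℕ → Set
Complex m = Face m → Bool

Γface : ∀ {m} → ℕ → Fin m → Face m
Γface n i = mkFace (λ j → (toℕ j ≤ᵇ suc n) ∧ not (toℕ j ≡ᵇ toℕ i)) (λ _ → false)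

-- Γ^n_I : subcomplex of ∂σ^{n+1} generated by the faces Γ^n_i, i ∈ I
-- (I given as a subset of Fin m; only i ≤ n+1 contribute)
Γ : ∀ {m} → ℕ → Vec Bool m → Complex m
Γ n I G = anyFin (λ i → lookup I i ∧ (toℕ i ≤ᵇ suc n) ∧ (G ⊆ᵇ Γface n i))

shift : ∀ {m} → Vec Bool m → Vec Bool m
shift I = tabulate (λ j → anyFin (λ i → lookup I i ∧ (suc (toℕ i) ≡ᵇ toℕ j)))

Fface : ∀ {m} → ℕ → ℕ → Face m
Fface n i = mkFace (λ j → (suc i ≤ᵇ toℕ j) ∧ (toℕ j ≤ᵇ suc n)) (λ _ → false)

vface : ∀ {m} → ℕ → Face m
vface i = mkFace (λ _ → false) (λ j → toℕ j ≡ᵇ i)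

link : ∀ {m} → Complex m → Face m → Complex m
link K F C = disjointᵇ C F ∧ K (C ∪F F)

-- membership in the join  ⟨v⟩ * ∂F * lk_K(F)  (v a new vertex not in K, F ∈ K):
-- G = A ∪ B ∪ C with A ⊆ {v}, B ⊊ F, C ∈ lk_K(F)
joinStar : ∀ {m} → Complex m → Face m → Face m → Complex m
joinStar K v F G = not (F ⊆ᵇ (G ∩F F)) ∧ link K F (G ∖F (v ∪F F))

-- one step: if F_i ∈ K, replace K by (K ∖ F_i) ∪ (⟨v_i⟩ * ∂F_i * lk_K(F_i)),
-- where K ∖ F_i is the set of faces of K not containing F_i
step : ∀ {m} → ℕ → ℕ → Complex m → Complex m
step n i K with K (Fface n i)
... | false = K
... | true  = λ G → (K G ∧ not (Fface n i ⊆ᵇ G)) ∨ joinStar K (vface i) (Fface n i) G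

steps : ∀ {m} → ℕ → ℕ → ℕ → Complex m → Complex m
steps n i zero    K = K
steps n i (suc k) K = steps n (suc i) k (step n i K)

◇ : ∀ {m} → ℕ → Complex m → Complex m
◇ n K = steps n 0 (suc n) K

data Vx : Set where
  o  : ℕ → Vx
  nv : ℕ → Vx

⌜_⌝ : ∀ {m} → V m → Vx
⌜ inj₁ j ⌝ = o (toℕ j)
⌜ inj₂ j ⌝ = nv (toℕ j)

-- ρ : i ↦ i-1, v_i ↦ v_{i-1}, indices mod d+1
ρ : ℕ → Vx → Vx
ρ d (o i)  = o ((i + d) % suc d)
ρ d (nv i) = nv ((i + d) % suc d)

ψ : ℕ → Vx → Vx
ψ d (o i)  = if i ≡ᵇ d then nv d else o i
ψ d (nv i) = if i ≡ᵇ d then o d else nv i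

σ : ℕ → Vx → Vx
σ d x = ψ d (ρ d x)

IsImage : ∀ {m} → (Vx → Vx) → Face m → Face m → Set
IsImage {m} f F G =
  ((v : V m) → v ∈F F → Σ (V m) (λ w → w ∈F G × (f ⌜ v ⌝ ≡ ⌜ w ⌝)))
  × ((w : V m) → w ∈F G → Σ (V m) (λ v → v ∈F F × (f ⌜ v ⌝ ≡ ⌜ w ⌝)))

Img : ∀ {m} → (Vx → Vx) → Complex m → Face m → Set
Img {m} f K G = Σ (Face m) (λ F → K F ≡ true × IsImage f F G)

IsInducedSub : ∀ {m} → (Face m → Set) → Complex m → Set
IsInducedSub {m} L K =
  ((G : Face m) → L G → K G ≡ true)
  × ((G : Face m) → K G ≡ true → ((v : V m) → v ∈F G → L (singleton v)) → L G)

module Submission where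

-- The faces after the steps 0, …, k-1 of ◇ⁿ(Γⁿ_I) are exactly the faces G admissible for some
-- apex i ∈ I: i ∉ G, G ⊆ {0,…,n+1} ∪ {v_i,…,v_{k-1}}, no j with i < j < k has both j and v_j in G,
-- and G misses a vertex of {k,…,n+1}; each step preserves this by a case analysis on whether G
-- contains v_k. For the final complexes, ρ rotates the indices 0,…,d and turns the faces with apex
-- i+1 into exactly the faces with apex i that avoid v_d, while σ = ψ ∘ ρ turns them into those that
-- avoid d. An admissible face with apex i < d never contains both d and v_d, which gives the union;
-- avoiding both is admissibility for ◇^{d-1}(Γ^{d-1}_I), which gives the intersection; and each image
-- is cut out of ◇^d(Γ^d_I) by excluding a single vertex, hence is induced.

open import Defs
open import Data.Bool using (Bool; true; false; _∧_; _∨_; not)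
open import Data.Bool.Properties using (T-≡; not-¬; ¬-not; not-injective; ∧-zeroʳ; ∧-identityʳ; ∨-zeroʳ; ∨-identityʳ; ∨-conicalʳ)
open import Data.Empty using (⊥; ⊥-elim)
open import Data.Nat using (ℕ; zero; suc; _+_; _∸_; _%_; _≤_; _<_; _≡ᵇ_; _≤ᵇ_; z≤n; s≤s; s≤s⁻¹; _<?_; _≟_)
open import Data.Nat.Properties
open import Data.Nat.DivMod using ([m+n]%n≡m%n; m≤n⇒m%n≡m; m%n<n)
open import Data.Fin using (Fin; toℕ; fromℕ<)
import Data.Fin as Fin
open import Data.Fin.Properties using (toℕ-fromℕ<; fromℕ<-toℕ; toℕ<n)
open import Data.Vec using (Vec; lookup; tabulate)
open import Data.Vec.Properties using (lookup∘tabulate)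
open import Data.Product using (Σ; _×_; _,_; proj₁; proj₂; uncurry)
open import Data.Sum using (_⊎_; inj₁; inj₂; [_,_]′)
open import Function.Base using (_∘_)
open import Function.Bundles using (_⇔_; mk⇔; Equivalence)
open import Function.Construct.Composition using (_⇔-∘_)
open import Function.Construct.Symmetry using (⇔-sym)
open import Relation.Nullary using (¬_; yes; no)
open import Relation.Binary.PropositionalEquality using (_≡_; _≢_; refl; sym; trans; cong; cong₂; subst; module ≡-Reasoning)

∧-true : ∀ {a b} → a ≡ true → b ≡ true → a ∧ b ≡ true
∧-true refl refl = refl

∧-true⁻ : ∀ a {b} → a ∧ b ≡ true → a ≡ true × b ≡ true
∧-true⁻ true e = refl , e

∨-true⁻ : ∀ a {b} → a ∨ b ≡ true → a ≡ true ⊎ b ≡ true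
∨-true⁻ true  _ = inj₁ refl
∨-true⁻ false e = inj₂ e

∨-trueˡ : ∀ {a} b → a ≡ true → a ∨ b ≡ true
∨-trueˡ _ refl = refl

∨-trueʳ : ∀ a {b} → b ≡ true → a ∨ b ≡ true
∨-trueʳ true  _ = refl
∨-trueʳ false e = e

≡true-ext : ∀ {a b} → (a ≡ true → b ≡ true) → (b ≡ true → a ≡ true) → a ≡ b
≡true-ext {true}  a⇒b _   = sym (a⇒b refl)
≡true-ext {false} _   b⇒a = sym (¬-not λ b≡true → not-¬ (b⇒a b≡true) refl)

not-true⁻ : ∀ {a} → not a ≡ true → a ≡ false
not-true⁻ {a} = not-injective {a} {false}

≤ᵇ-true⁻ : ∀ {a b} → (a ≤ᵇ b) ≡ true → a ≤ b
≤ᵇ-true⁻ {a} {b} e = ≤ᵇ⇒≤ a b (Equivalence.from T-≡ e)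

≤ᵇ-true : ∀ {a b} → a ≤ b → (a ≤ᵇ b) ≡ true
≤ᵇ-true a≤b = Equivalence.to T-≡ (≤⇒≤ᵇ a≤b)

≡ᵇ-true⁻ : ∀ {a b} → (a ≡ᵇ b) ≡ true → a ≡ b
≡ᵇ-true⁻ {a} {b} e = ≡ᵇ⇒≡ a b (Equivalence.from T-≡ e)

≡ᵇ-true : ∀ {a b} → a ≡ b → (a ≡ᵇ b) ≡ true
≡ᵇ-true {a} {b} a≡b = Equivalence.to T-≡ (≡⇒≡ᵇ a b a≡b)

anyFin-true⁻ : ∀ {m} (p : Fin m → Bool) → anyFin p ≡ true → Σ (Fin m) λ j → p j ≡ true
anyFin-true⁻ {suc m} p e with ∨-true⁻ (p Fin.zero) e
... | inj₁ p0 = Fin.zero , p0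
... | inj₂ ps with anyFin-true⁻ (λ j → p (Fin.suc j)) ps
...   | j , pj = Fin.suc j , pj

anyFin-true : ∀ {m} (p : Fin m → Bool) (j : Fin m) → p j ≡ true → anyFin p ≡ true
anyFin-true p Fin.zero    e = ∨-trueˡ _ e
anyFin-true p (Fin.suc j) e = ∨-trueʳ (p Fin.zero) (anyFin-true (λ j → p (Fin.suc j)) j e)

allFin-true⁻ : ∀ {m} (p : Fin m → Bool) → allFin p ≡ true → ∀ j → p j ≡ true
allFin-true⁻ p e Fin.zero    = proj₁ (∧-true⁻ (p Fin.zero) e)
allFin-true⁻ p e (Fin.suc j) = allFin-true⁻ (λ j → p (Fin.suc j)) (proj₂ (∧-true⁻ (p Fin.zero) e)) j

allFin-true : ∀ {m} (p : Fin m → Bool) → (∀ j → p j ≡ true) → allFin p ≡ true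
allFin-true {zero}  p h = refl
allFin-true {suc m} p h = ∧-true (h Fin.zero) (allFin-true (λ j → p (Fin.suc j)) (λ j → h (Fin.suc j)))

-- Faces as sets of vertex labels, indexed by ℕ rather than Fin m (membership is false out of range).

lookupℕ : ∀ {m} → Vec Bool m → ℕ → Bool
lookupℕ {m} v a with a <? m
... | yes a<m = lookup v (fromℕ< a<m)
... | no  _   = false

lookupℕ-toℕ : ∀ {m} (v : Vec Bool m) (j : Fin m) → lookupℕ v (toℕ j) ≡ lookup v j
lookupℕ-toℕ {m} v j with toℕ j <? m
... | yes j<m = cong (lookup v) (fromℕ<-toℕ j j<m)
... | no  j≮m = ⊥-elim (j≮m (toℕ<n j))

lookupℕ-outside : ∀ {m} (v : Vec Bool m) {a} → m ≤ a → lookupℕ v a ≡ false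
lookupℕ-outside {m} v {a} m≤a with a <? m
... | yes a<m = ⊥-elim (<⇒≱ a<m m≤a)
... | no  _   = refl

index : Vx → ℕ
index (o a)  = a
index (nv a) = a

infix 7 _∋_
_∋_ : ∀ {m} → Face m → Vx → Bool
G ∋ o a  = lookupℕ (proj₁ G) a
G ∋ nv a = lookupℕ (proj₂ G) a

∈ᵇ⇒∋ : ∀ {m} (v : V m) (G : Face m) → v ∈ᵇ G ≡ G ∋ ⌜ v ⌝
∈ᵇ⇒∋ (inj₁ j) G = sym (lookupℕ-toℕ (proj₁ G) j)
∈ᵇ⇒∋ (inj₂ j) G = sym (lookupℕ-toℕ (proj₂ G) j)

∈F⇒∋ : ∀ {m} (v : V m) (G : Face m) → v ∈F G → G ∋ ⌜ v ⌝ ≡ true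
∈F⇒∋ v G v∈G = trans (sym (∈ᵇ⇒∋ v G)) v∈G

∋-outside : ∀ {m} (G : Face m) x → m ≤ index x → G ∋ x ≡ false
∋-outside G (o a)  = lookupℕ-outside (proj₁ G)
∋-outside G (nv a) = lookupℕ-outside (proj₂ G)

∋⇒index< : ∀ {m} (G : Face m) x → G ∋ x ≡ true → index x < m
∋⇒index< G x e = ≰⇒> (λ m≤x → not-¬ e (∋-outside G x m≤x))

vertex : ∀ {m} (x : Vx) → index x < m → V m
vertex (o a)  a<m = inj₁ (fromℕ< a<m)
vertex (nv a) a<m = inj₂ (fromℕ< a<m)

⌜vertex⌝ : ∀ {m} (x : Vx) (x<m : index x < m) → ⌜ vertex {m} x x<m ⌝ ≡ x
⌜vertex⌝ (o a)  a<m = cong o (toℕ-fromℕ< a<m)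
⌜vertex⌝ (nv a) a<m = cong nv (toℕ-fromℕ< a<m)

∋⇒∈F : ∀ {m} (G : Face m) x (e : G ∋ x ≡ true) → vertex x (∋⇒index< G x e) ∈F G
∋⇒∈F G x e = trans (∈ᵇ⇒∋ (vertex x x<m) G) (subst (λ y → G ∋ y ≡ true) (sym (⌜vertex⌝ x x<m)) e)
  where
  x<m : index x < _
  x<m = ∋⇒index< G x e

mkFace-∋ : ∀ {m} (p q : Fin m → Bool) (r : Vx → Bool)
  → (∀ j → p j ≡ r (o (toℕ j))) → (∀ j → q j ≡ r (nv (toℕ j)))
  → (∀ x → m ≤ index x → r x ≡ false)
  → ∀ x → mkFace p q ∋ x ≡ r x
mkFace-∋ {m} p q r hp hq hout x with index x <? m
... | no x≮m = trans (∋-outside (mkFace p q) x (≮⇒≥ x≮m)) (sym (hout x (≮⇒≥ x≮m)))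
... | yes x<m = begin
  mkFace p q ∋ x                 ≡⟨ cong (mkFace p q ∋_) (sym (⌜vertex⌝ x x<m)) ⟩
  mkFace p q ∋ ⌜ v ⌝             ≡⟨ sym (∈ᵇ⇒∋ v (mkFace p q)) ⟩
  v ∈ᵇ mkFace p q                ≡⟨ tabulated v ⟩
  r ⌜ v ⌝                        ≡⟨ cong r (⌜vertex⌝ x x<m) ⟩
  r x                            ∎
  where
  open ≡-Reasoning
  v : V _
  v = vertex x x<m
  tabulated : ∀ v → v ∈ᵇ mkFace p q ≡ r ⌜ v ⌝
  tabulated (inj₁ j) = trans (lookup∘tabulate p j) (hp j)
  tabulated (inj₂ j) = trans (lookup∘tabulate q j) (hq j)

faceOf : ∀ {m} → (Vx → Bool) → Face m
faceOf p = mkFace (λ j → p (o (toℕ j))) (λ j → p (nv (toℕ j)))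

faceOf-∋ : ∀ {m} (p : Vx → Bool) → (∀ x → m ≤ index x → p x ≡ false) → ∀ x → faceOf {m} p ∋ x ≡ p x
faceOf-∋ p = mkFace-∋ _ _ p (λ _ → refl) (λ _ → refl)

∋-pointwise : ∀ {m} (_⊕_ : Bool → Bool → Bool) → (false ⊕ false) ≡ false → (F G : Face m) → ∀ x
  → mkFace (λ j → (inj₁ j ∈ᵇ F) ⊕ (inj₁ j ∈ᵇ G)) (λ j → (inj₂ j ∈ᵇ F) ⊕ (inj₂ j ∈ᵇ G)) ∋ x ≡ ((F ∋ x) ⊕ (G ∋ x))
∋-pointwise _⊕_ ⊕-false F G = mkFace-∋ _ _ (λ x → (F ∋ x) ⊕ (G ∋ x))
  (λ j → cong₂ _⊕_ (∈ᵇ⇒∋ (inj₁ j) F) (∈ᵇ⇒∋ (inj₁ j) G))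
  (λ j → cong₂ _⊕_ (∈ᵇ⇒∋ (inj₂ j) F) (∈ᵇ⇒∋ (inj₂ j) G))
  (λ x m≤x → trans (cong₂ _⊕_ (∋-outside F x m≤x) (∋-outside G x m≤x)) ⊕-false)

∪F-∋ : ∀ {m} (F G : Face m) x → (F ∪F G) ∋ x ≡ (F ∋ x ∨ G ∋ x)
∪F-∋ = ∋-pointwise _∨_ refl

∩F-∋ : ∀ {m} (F G : Face m) x → (F ∩F G) ∋ x ≡ (F ∋ x ∧ G ∋ x)
∩F-∋ = ∋-pointwise _∧_ refl

∖F-∋ : ∀ {m} (F G : Face m) x → (F ∖F G) ∋ x ≡ (F ∋ x ∧ not (G ∋ x))
∖F-∋ = ∋-pointwise (λ a b → a ∧ not b) refl

_⊆_ : ∀ {m} → Face m → Face m → Set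
F ⊆ G = ∀ x → F ∋ x ≡ true → G ∋ x ≡ true

allV : ∀ {m} → (V m → Bool) → Bool
allV p = allFin (λ j → p (inj₁ j)) ∧ allFin (λ j → p (inj₂ j))

allV-true⁻ : ∀ {m} (p : V m → Bool) → allV p ≡ true → ∀ v → p v ≡ true
allV-true⁻ p e (inj₁ j) = allFin-true⁻ _ (proj₁ (∧-true⁻ _ e)) j
allV-true⁻ p e (inj₂ j) = allFin-true⁻ _ (proj₂ (∧-true⁻ _ e)) j

allV-true : ∀ {m} (p : V m → Bool) → (∀ v → p v ≡ true) → allV p ≡ true
allV-true p h = ∧-true (allFin-true _ (λ j → h (inj₁ j))) (allFin-true _ (λ j → h (inj₂ j)))

⊆ᵇ⇒⊆ : ∀ {m} (F G : Face m) → (F ⊆ᵇ G) ≡ true → F ⊆ G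
⊆ᵇ⇒⊆ F G e x x∈F = subst (λ y → G ∋ y ≡ true) (⌜vertex⌝ x x<m) (begin
  G ∋ ⌜ v ⌝    ≡⟨ sym (∈ᵇ⇒∋ v G) ⟩
  v ∈ᵇ G       ≡⟨ implied (allV-true⁻ (λ v → not (v ∈ᵇ F) ∨ (v ∈ᵇ G)) e v) (∋⇒∈F F x x∈F) ⟩
  true         ∎)
  where
  open ≡-Reasoning
  x<m : index x < _
  x<m = ∋⇒index< F x x∈F
  v : V _
  v = vertex x x<m
  implied : ∀ {a b} → not a ∨ b ≡ true → a ≡ true → b ≡ true
  implied e refl = e

⊆⇒⊆ᵇ : ∀ {m} (F G : Face m) → F ⊆ G → (F ⊆ᵇ G) ≡ true
⊆⇒⊆ᵇ F G F⊆G = allV-true _ implication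
  where
  implication : ∀ v → not (v ∈ᵇ F) ∨ (v ∈ᵇ G) ≡ true
  implication v with v ∈ᵇ F in v∈F
  ... | false = refl
  ... | true  = trans (∈ᵇ⇒∋ v G) (F⊆G ⌜ v ⌝ (∈F⇒∋ v F v∈F))

disjointᵇ-true : ∀ {m} (F G : Face m) → (∀ x → F ∋ x ≡ true → G ∋ x ≡ false) → disjointᵇ F G ≡ true
disjointᵇ-true F G disjoint = allV-true _ apart
  where
  apart : ∀ v → not ((v ∈ᵇ F) ∧ (v ∈ᵇ G)) ≡ true
  apart v with v ∈ᵇ F in v∈F
  ... | false = refl
  ... | true  = cong not (trans (∈ᵇ⇒∋ v G) (disjoint ⌜ v ⌝ (∈F⇒∋ v F v∈F)))

lookupℕ-true⇒< : ∀ {m} (v : Vec Bool m) {a} → lookupℕ v a ≡ true → a < m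
lookupℕ-true⇒< v e = ≰⇒> (λ m≤a → not-¬ e (lookupℕ-outside v m≤a))

lookupℕ-fromℕ< : ∀ {m} (v : Vec Bool m) {a} (a<m : a < m) → lookup v (fromℕ< a<m) ≡ lookupℕ v a
lookupℕ-fromℕ< v a<m = trans (sym (lookupℕ-toℕ v _)) (cong (lookupℕ v) (toℕ-fromℕ< a<m))

≤ᵇ-false : ∀ {a b} → b < a → (a ≤ᵇ b) ≡ false
≤ᵇ-false b<a = ¬-not (λ e → <⇒≱ b<a (≤ᵇ-true⁻ e))

≡ᵇ-false : ∀ {a b} → a ≢ b → (a ≡ᵇ b) ≡ false
≡ᵇ-false a≢b = ¬-not (λ e → a≢b (≡ᵇ-true⁻ e))

Γlabel : ℕ → ℕ → Vx → Bool
Γlabel n i (o a)  = (a ≤ᵇ suc n) ∧ not (a ≡ᵇ i)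
Γlabel n i (nv a) = false

Γface-∋ : ∀ {m} n (i : Fin m) → suc (suc n) ≤ m → ∀ x → Γface n i ∋ x ≡ Γlabel n (toℕ i) x
Γface-∋ n i n+2≤m = mkFace-∋ _ _ (Γlabel n (toℕ i)) (λ _ → refl) (λ _ → refl) outside
  where
  outside : ∀ x → _ ≤ index x → Γlabel n (toℕ i) x ≡ false
  outside (o a)  m≤a = cong (_∧ _) (≤ᵇ-false (≤-trans n+2≤m m≤a))
  outside (nv a) _   = refl

Flabel : ℕ → ℕ → Vx → Bool
Flabel n k (o a)  = (suc k ≤ᵇ a) ∧ (a ≤ᵇ suc n)
Flabel n k (nv a) = false

Fface-∋ : ∀ {m} n k → suc (suc n) ≤ m → ∀ x → Fface {m} n k ∋ x ≡ Flabel n k x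
Fface-∋ n k n+2≤m = mkFace-∋ _ _ (Flabel n k) (λ _ → refl) (λ _ → refl) outside
  where
  outside : ∀ x → _ ≤ index x → Flabel n k x ≡ false
  outside (o a)  m≤a = trans (cong (_ ∧_) (≤ᵇ-false (≤-trans n+2≤m m≤a))) (∧-zeroʳ _)
  outside (nv a) _   = refl

vlabel : ℕ → Vx → Bool
vlabel k (o a)  = false
vlabel k (nv a) = a ≡ᵇ k

vface-∋ : ∀ {m} k → k < m → ∀ x → vface {m} k ∋ x ≡ vlabel k x
vface-∋ k k<m = mkFace-∋ _ _ (vlabel k) (λ _ → refl) (λ _ → refl) outside
  where
  outside : ∀ x → _ ≤ index x → vlabel k x ≡ false
  outside (o a)  _   = refl
  outside (nv a) m≤a = ≡ᵇ-false (λ a≡k → <⇒≱ k<m (subst (_ ≤_) a≡k m≤a))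

singleton-self : ∀ {m} (v : V m) → v ∈F singleton v
singleton-self (inj₁ j) = trans (lookup∘tabulate _ j) (≡ᵇ-true {toℕ j} refl)
singleton-self (inj₂ j) = trans (lookup∘tabulate _ j) (≡ᵇ-true {toℕ j} refl)

Covers : ∀ {m} → ℕ → ℕ → Face m → Set
Covers n k G = ∀ a → k ≤ a → a ≤ suc n → G ∋ o a ≡ true

record Admissible {m} (n k i : ℕ) (G : Face m) : Set where
  field
    apex∉   : G ∋ o i ≡ false
    orig≤   : ∀ a → G ∋ o a ≡ true → a ≤ suc n
    new∈    : ∀ a → G ∋ nv a ≡ true → i ≤ a × a < k
    ¬pair   : ∀ a → i < a → a < k → G ∋ o a ≡ true → G ∋ nv a ≡ true → ⊥
    ¬covers : ¬ Covers n k G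
open Admissible

Admitted : ∀ {m} → ℕ → ℕ → Vec Bool m → Face m → Set
Admitted n k I G = Σ ℕ λ i → lookupℕ I i ≡ true × Admissible n k i G

Characterises : ∀ {m} → ℕ → ℕ → Vec Bool m → Complex m → Set
Characterises n k I K = ∀ G → K G ≡ true ⇔ Admitted n k I G

ApexBound : ∀ {m} → ℕ → Vec Bool m → Set
ApexBound n I = ∀ i → lookupℕ I i ≡ true → i ≤ n

⊆Γface⇒Admissible : ∀ {m} n (i : Fin m) (G : Face m) → suc (suc n) ≤ m → toℕ i ≤ suc n
  → G ⊆ Γface n i → Admissible n 0 (toℕ i) G
⊆Γface⇒Admissible n i G n+2≤m i≤n+1 G⊆Γ = record
  { apex∉   = i∉G
  ; orig≤   = λ a a∈G → ≤ᵇ-true⁻ (proj₁ (∧-true⁻ _ (in-Γ (o a) a∈G)))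
  ; new∈    = λ a a∈G → ⊥-elim (not-¬ (in-Γ (nv a) a∈G) refl)
  ; ¬pair   = λ _ _ ()
  ; ¬covers = λ covers → not-¬ (covers (toℕ i) z≤n i≤n+1) i∉G
  }
  where
  in-Γ : ∀ x → G ∋ x ≡ true → Γlabel n (toℕ i) x ≡ true
  in-Γ x x∈G = trans (sym (Γface-∋ n i n+2≤m x)) (G⊆Γ x x∈G)
  i∉G : G ∋ o (toℕ i) ≡ false
  i∉G = ¬-not λ i∈G → not-¬ (in-Γ (o (toℕ i)) i∈G)
          (trans (cong (λ b → (toℕ i ≤ᵇ suc n) ∧ not b) (≡ᵇ-true {toℕ i} refl)) (∧-zeroʳ _))

Admissible⇒⊆Γface : ∀ {m} n (i : Fin m) (G : Face m) → suc (suc n) ≤ m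
  → Admissible n 0 (toℕ i) G → G ⊆ Γface n i
Admissible⇒⊆Γface n i G n+2≤m adm x x∈G = trans (Γface-∋ n i n+2≤m x) (in-Γ x x∈G)
  where
  in-Γ : ∀ x → G ∋ x ≡ true → Γlabel n (toℕ i) x ≡ true
  in-Γ (o a)  a∈G = ∧-true (≤ᵇ-true (orig≤ adm a a∈G))
                      (cong not (≡ᵇ-false {a} {toℕ i} λ { refl → not-¬ a∈G (apex∉ adm) }))
  in-Γ (nv a) a∈G = ⊥-elim (<⇒≱ (proj₂ (new∈ adm a a∈G)) z≤n)

Γ-characterisation : ∀ {m} n (I : Vec Bool m) → suc (suc n) ≤ m → ApexBound n I → Characterises n 0 I (Γ n I)
Γ-characterisation n I n+2≤m I≤n G = mk⇔ to from
  where
  to : Γ n I G ≡ true → Admitted n 0 I G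
  to e with anyFin-true⁻ _ e
  ... | i , chosen with ∧-true⁻ (lookup I i) chosen
  ...   | i∈I , rest with ∧-true⁻ (toℕ i ≤ᵇ suc n) rest
  ...     | i≤n+1 , G⊆Γ = toℕ i , trans (lookupℕ-toℕ I i) i∈I
                          , ⊆Γface⇒Admissible n i G n+2≤m (≤ᵇ-true⁻ i≤n+1) (⊆ᵇ⇒⊆ G (Γface n i) G⊆Γ)
  from : Admitted n 0 I G → Γ n I G ≡ true
  from (a , a∈I , adm) = anyFin-true _ i (∧-true (trans (lookupℕ-fromℕ< I a<m) a∈I)
      (∧-true (≤ᵇ-true i≤n+1) (⊆⇒⊆ᵇ G (Γface n i) (Admissible⇒⊆Γface n i G n+2≤m adm′))))
    where
    a<m : a < _
    a<m = lookupℕ-true⇒< I a∈I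
    i : Fin _
    i = fromℕ< a<m
    i≤n+1 : toℕ i ≤ suc n
    i≤n+1 = subst (_≤ suc n) (sym (toℕ-fromℕ< a<m)) (≤-trans (I≤n a a∈I) (n≤1+n n))
    adm′ : Admissible n 0 (toℕ i) G
    adm′ = subst (λ b → Admissible n 0 b G) (sym (toℕ-fromℕ< a<m)) adm

not-⊆ᵇ⇒⊈ : ∀ {m} (F G : Face m) → not (F ⊆ᵇ G) ≡ true → ¬ F ⊆ G
not-⊆ᵇ⇒⊈ F G e F⊆G = not-¬ (⊆⇒⊆ᵇ F G F⊆G) (not-true⁻ e)

⊈⇒not-⊆ᵇ : ∀ {m} (F G : Face m) → ¬ F ⊆ G → not (F ⊆ᵇ G) ≡ true
⊈⇒not-⊆ᵇ F G F⊈G = cong not (¬-not λ e → F⊈G (⊆ᵇ⇒⊆ F G e))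

⊆∩F⇒⊆ : ∀ {m} (F G : Face m) → F ⊆ (G ∩F F) → F ⊆ G
⊆∩F⇒⊆ F G F⊆G∩F x x∈F = proj₁ (∧-true⁻ _ (trans (sym (∩F-∋ G F x)) (F⊆G∩F x x∈F)))

⊆⇒⊆∩F : ∀ {m} (F G : Face m) → F ⊆ G → F ⊆ (G ∩F F)
⊆⇒⊆∩F F G F⊆G x x∈F = trans (∩F-∋ G F x) (∧-true (F⊆G x x∈F) x∈F)

disjointᵇ-∖∪ : ∀ {m} (G H F : Face m) → disjointᵇ (G ∖F (H ∪F F)) F ≡ true
disjointᵇ-∖∪ G H F = disjointᵇ-true _ F λ x x∈G∖ →
  ∨-conicalʳ (H ∋ x) (F ∋ x) (trans (sym (∪F-∋ H F x))
    (not-true⁻ (proj₂ (∧-true⁻ (G ∋ x) (trans (sym (∖F-∋ G (H ∪F F) x)) x∈G∖)))))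

apex-uncovered : ∀ {m n k i j} {G : Face m} → Admissible n k i G → j ≤ i → i ≤ suc n → ¬ Covers n j G
apex-uncovered {i = i} p j≤i i≤n+1 covers = not-¬ (covers i j≤i i≤n+1) (apex∉ p)

module Step {m : ℕ} (n k : ℕ) (n+2≤m : suc (suc n) ≤ m) (k≤n : k ≤ n) where

  k≤n+1 : k ≤ suc n
  k≤n+1 = ≤-trans k≤n (n≤1+n n)

  F : Face m
  F = Fface n k

  F∋o⁻ : ∀ a → F ∋ o a ≡ true → k < a × a ≤ suc n
  F∋o⁻ a e with ∧-true⁻ (suc k ≤ᵇ a) (trans (sym (Fface-∋ n k n+2≤m (o a))) e)
  ... | k<a , a≤n+1 = ≤ᵇ-true⁻ k<a , ≤ᵇ-true⁻ a≤n+1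

  F∋o : ∀ a → k < a → a ≤ suc n → F ∋ o a ≡ true
  F∋o a k<a a≤n+1 = trans (Fface-∋ n k n+2≤m (o a)) (∧-true (≤ᵇ-true k<a) (≤ᵇ-true a≤n+1))

  F∌nv : ∀ a → F ∋ nv a ≡ false
  F∌nv a = Fface-∋ n k n+2≤m (nv a)

  F⊆⇒Covers : ∀ G → F ⊆ G → Covers n (suc k) G
  F⊆⇒Covers G F⊆G a k<a a≤n+1 = F⊆G (o a) (F∋o a k<a a≤n+1)

  Covers⇒F⊆ : ∀ G → Covers n (suc k) G → F ⊆ G
  Covers⇒F⊆ G covers (o a)  e = uncurry (covers a) (F∋o⁻ a e)
  Covers⇒F⊆ G covers (nv a) e = ⊥-elim (not-¬ e (F∌nv a))

  -- The face C ∪ F_k of K through whose link C the face G enters ⟨v_k⟩ * ∂F_k * lk(F_k).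
  cone : Face m → Face m
  cone G = (G ∖F (vface k ∪F F)) ∪F F

  cone-∋ : ∀ G x → cone G ∋ x ≡ ((G ∋ x ∧ not (vlabel k x ∨ F ∋ x)) ∨ F ∋ x)
  cone-∋ G x = begin
    cone G ∋ x                                    ≡⟨ ∪F-∋ _ F x ⟩
    (G ∖F (vface k ∪F F)) ∋ x ∨ F ∋ x             ≡⟨ cong (_∨ F ∋ x) (∖F-∋ G _ x) ⟩
    (G ∋ x ∧ not ((vface k ∪F F) ∋ x)) ∨ F ∋ x    ≡⟨ cong (λ b → (G ∋ x ∧ not b) ∨ F ∋ x) (∪F-∋ (vface k) F x) ⟩
    (G ∋ x ∧ not (vface k ∋ x ∨ F ∋ x)) ∨ F ∋ x   ≡⟨ cong (λ b → (G ∋ x ∧ not (b ∨ F ∋ x)) ∨ F ∋ x) (vface-∋ k k<m x) ⟩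
    (G ∋ x ∧ not (vlabel k x ∨ F ∋ x)) ∨ F ∋ x    ∎
    where
    open ≡-Reasoning
    k<m : k < m
    k<m = ≤-trans (s≤s k≤n+1) n+2≤m

  cone-∋o : ∀ G a → cone G ∋ o a ≡ (G ∋ o a ∨ F ∋ o a)
  cone-∋o G a = trans (cone-∋ G (o a)) (absorb (G ∋ o a) (F ∋ o a))
    where
    absorb : ∀ b c → (b ∧ not c) ∨ c ≡ b ∨ c
    absorb b true  = trans (∨-zeroʳ _) (sym (∨-zeroʳ b))
    absorb b false = cong (_∨ false) (∧-identityʳ b)

  cone-∋nv : ∀ G a → cone G ∋ nv a ≡ (G ∋ nv a ∧ not (a ≡ᵇ k))
  cone-∋nv G a = begin
    cone G ∋ nv a                                            ≡⟨ cone-∋ G (nv a) ⟩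
    (G ∋ nv a ∧ not ((a ≡ᵇ k) ∨ F ∋ nv a)) ∨ F ∋ nv a        ≡⟨ cong (λ b → (G ∋ nv a ∧ not ((a ≡ᵇ k) ∨ b)) ∨ b) (F∌nv a) ⟩
    (G ∋ nv a ∧ not ((a ≡ᵇ k) ∨ false)) ∨ false              ≡⟨ ∨-identityʳ _ ⟩
    G ∋ nv a ∧ not ((a ≡ᵇ k) ∨ false)                        ≡⟨ cong (λ b → G ∋ nv a ∧ not b) (∨-identityʳ _) ⟩
    G ∋ nv a ∧ not (a ≡ᵇ k)                                  ∎
    where open ≡-Reasoning

  cone-o⁻ : ∀ G a → cone G ∋ o a ≡ true → G ∋ o a ≡ true ⊎ F ∋ o a ≡ true
  cone-o⁻ G a e = ∨-true⁻ _ (trans (sym (cone-∋o G a)) e)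

  G⊆cone-o : ∀ G a → G ∋ o a ≡ true → cone G ∋ o a ≡ true
  G⊆cone-o G a e = trans (cone-∋o G a) (∨-trueˡ _ e)

  F⊆cone-o : ∀ G a → F ∋ o a ≡ true → cone G ∋ o a ≡ true
  F⊆cone-o G a e = trans (cone-∋o G a) (∨-trueʳ (G ∋ o a) e)

  cone-nv⁻ : ∀ G a → cone G ∋ nv a ≡ true → G ∋ nv a ≡ true × a ≢ k
  cone-nv⁻ G a e with ∧-true⁻ (G ∋ nv a) (trans (sym (cone-∋nv G a)) e)
  ... | a∈G , a≢ᵇk = a∈G , λ a≡k → not-¬ (≡ᵇ-true a≡k) (not-true⁻ a≢ᵇk)

  cone-nv : ∀ G a → G ∋ nv a ≡ true → a ≢ k → cone G ∋ nv a ≡ true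
  cone-nv G a e a≢k = trans (cone-∋nv G a) (∧-true e (cong not (≡ᵇ-false a≢k)))

  F-admissible : ∀ {i} → i ≤ k → Admissible n k i F
  F-admissible i≤k = record
    { apex∉   = ¬-not λ i∈F → <⇒≱ (proj₁ (F∋o⁻ _ i∈F)) i≤k
    ; orig≤   = λ a a∈F → proj₂ (F∋o⁻ a a∈F)
    ; new∈    = λ a a∈F → ⊥-elim (not-¬ a∈F (F∌nv a))
    ; ¬pair   = λ a _ _ _ a∈F → not-¬ a∈F (F∌nv a)
    ; ¬covers = λ covers → <-irrefl refl (proj₁ (F∋o⁻ k (covers k ≤-refl k≤n+1)))
    }

  Admissible⇒F⊈ : ∀ {i} {G : Face m} → Admissible n (suc k) i G → ¬ F ⊆ G
  Admissible⇒F⊈ {G = G} p F⊆G = ¬covers p (F⊆⇒Covers G F⊆G)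

  Admissible-above : ∀ {i} {G : Face m} → k < i → i ≤ n → Admissible n k i G ⇔ Admissible n (suc k) i G
  Admissible-above {i} k<i i≤n = mk⇔
    (λ p → record
      { apex∉   = apex∉ p
      ; orig≤   = orig≤ p
      ; new∈    = λ a e → ⊥-elim (<⇒≱ (proj₂ (new∈ p a e)) (≤-trans (<⇒≤ k<i) (proj₁ (new∈ p a e))))
      ; ¬pair   = λ a i<a a≤k _ _ → <⇒≱ k<i (≤-trans (<⇒≤ i<a) (s≤s⁻¹ a≤k))
      ; ¬covers = apex-uncovered p k<i i≤n+1
      })
    (λ p → record
      { apex∉   = apex∉ p
      ; orig≤   = orig≤ p
      ; new∈    = λ a e → ⊥-elim (<⇒≱ k<i (≤-trans (proj₁ (new∈ p a e)) (s≤s⁻¹ (proj₂ (new∈ p a e)))))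
      ; ¬pair   = λ a i<a a<k _ _ → <⇒≱ k<i (≤-trans (<⇒≤ i<a) (<⇒≤ a<k))
      ; ¬covers = apex-uncovered p (<⇒≤ k<i) i≤n+1
      })
    where
    i≤n+1 : i ≤ suc n
    i≤n+1 = ≤-trans i≤n (n≤1+n n)

  Admissible-keep : ∀ {i} {G : Face m} → Admissible n k i G → ¬ Covers n (suc k) G → Admissible n (suc k) i G
  Admissible-keep p G-uncovered = record
    { apex∉   = apex∉ p
    ; orig≤   = orig≤ p
    ; new∈    = λ a e → proj₁ (new∈ p a e) , m<n⇒m<1+n (proj₂ (new∈ p a e))
    ; ¬pair   = λ a i<a _ oa na → ¬pair p a i<a (proj₂ (new∈ p a na)) oa na
    ; ¬covers = G-uncovered
    }

  Admissible-drop : ∀ {i} {G : Face m} → Admissible n (suc k) i G → G ∋ nv k ≡ false → Admissible n k i G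
  Admissible-drop {G = G} p vk∉G = record
    { apex∉   = apex∉ p
    ; orig≤   = orig≤ p
    ; new∈    = λ a e → proj₁ (new∈ p a e)
                        , ≤∧≢⇒< (s≤s⁻¹ (proj₂ (new∈ p a e))) λ { refl → not-¬ e vk∉G }
    ; ¬pair   = λ a i<a a<k → ¬pair p a i<a (m<n⇒m<1+n a<k)
    ; ¬covers = λ covers → ¬covers p (λ a k<a → covers a (<⇒≤ k<a))
    }

  Admissible-uncone : ∀ {i} {G : Face m} → i ≤ n → Admissible n k i (cone G) → ¬ Covers n (suc k) G
    → Admissible n (suc k) i G
  Admissible-uncone {i} {G} i≤n p G-uncovered = record
    { apex∉   = ¬-not λ i∈G → not-¬ (G⊆cone-o G i i∈G) (apex∉ p)
    ; orig≤   = λ a a∈G → orig≤ p a (G⊆cone-o G a a∈G)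
    ; new∈    = new∈′
    ; ¬pair   = ¬pair′
    ; ¬covers = G-uncovered
    }
    where
    k∉G : G ∋ o k ≡ false
    k∉G = ¬-not λ k∈G → ¬covers p λ a k≤a a≤n+1 → [ (λ k<a → F⊆cone-o G a (F∋o a k<a a≤n+1))
                                                    , (λ { refl → G⊆cone-o G k k∈G }) ]′ (m≤n⇒m<n∨m≡n k≤a)
    i≤k : i ≤ k
    i≤k = ≮⇒≥ λ k<i → not-¬ (F⊆cone-o G i (F∋o i k<i (≤-trans i≤n (n≤1+n n)))) (apex∉ p)
    new∈′ : ∀ a → G ∋ nv a ≡ true → i ≤ a × a < suc k
    new∈′ a e with a ≟ k
    ... | yes refl = i≤k , ≤-refl
    ... | no  a≢k  = proj₁ (new∈ p a (cone-nv G a e a≢k)) , m<n⇒m<1+n (proj₂ (new∈ p a (cone-nv G a e a≢k)))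
    ¬pair′ : ∀ a → i < a → a < suc k → G ∋ o a ≡ true → G ∋ nv a ≡ true → ⊥
    ¬pair′ a i<a a≤k oa na with a ≟ k
    ... | yes refl = not-¬ oa k∉G
    ... | no  a≢k  = ¬pair p a i<a (≤∧≢⇒< (s≤s⁻¹ a≤k) a≢k) (G⊆cone-o G a oa) (cone-nv G a na a≢k)

  Admissible-cone : ∀ {i} {G : Face m} → Admissible n (suc k) i G → i ≤ k → G ∋ nv k ≡ true
    → Admissible n k i (cone G)
  Admissible-cone {i} {G} p i≤k vk∈G = record
    { apex∉   = ¬-not λ i∈cone → [ (λ i∈G → not-¬ i∈G (apex∉ p))
                                 , (λ i∈F → <⇒≱ (proj₁ (F∋o⁻ i i∈F)) i≤k) ]′ (cone-o⁻ G i i∈cone)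
    ; orig≤   = λ a e → [ orig≤ p a , (λ a∈F → proj₂ (F∋o⁻ a a∈F)) ]′ (cone-o⁻ G a e)
    ; new∈    = new∈′
    ; ¬pair   = ¬pair′
    ; ¬covers = λ covers → [ (λ k∈G → not-¬ k∈G k∉G) , (λ k∈F → <-irrefl refl (proj₁ (F∋o⁻ k k∈F))) ]′
                             (cone-o⁻ G k (covers k ≤-refl k≤n+1))
    }
    where
    k∉G : G ∋ o k ≡ false
    k∉G with m≤n⇒m<n∨m≡n i≤k
    ... | inj₁ i<k  = ¬-not λ k∈G → ¬pair p k i<k ≤-refl k∈G vk∈G
    ... | inj₂ refl = apex∉ p
    new∈′ : ∀ a → cone G ∋ nv a ≡ true → i ≤ a × a < k
    new∈′ a e with cone-nv⁻ G a e
    ... | a∈G , a≢k = proj₁ (new∈ p a a∈G) , ≤∧≢⇒< (s≤s⁻¹ (proj₂ (new∈ p a a∈G))) a≢k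
    ¬pair′ : ∀ a → i < a → a < k → cone G ∋ o a ≡ true → cone G ∋ nv a ≡ true → ⊥
    ¬pair′ a i<a a<k oa na = [ (λ a∈G → ¬pair p a i<a (m<n⇒m<1+n a<k) a∈G (proj₁ (cone-nv⁻ G a na)))
                             , (λ a∈F → <⇒≱ a<k (<⇒≤ (proj₁ (F∋o⁻ a a∈F)))) ]′ (cone-o⁻ G a oa)

  characterisation-F∉K : (I : Vec Bool m) → ApexBound n I → (K : Complex m)
    → Characterises n k I K → K F ≡ false → Characterises n (suc k) I K
  characterisation-F∉K I I≤n K χ F∉K G = mk⇔ to from
    where
    apex-above : ∀ i → lookupℕ I i ≡ true → k < i
    apex-above i i∈I = ≰⇒> λ i≤k → not-¬ (Equivalence.from (χ F) (i , i∈I , F-admissible i≤k)) F∉K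
    to : K G ≡ true → Admitted n (suc k) I G
    to G∈K with Equivalence.to (χ G) G∈K
    ... | i , i∈I , p = i , i∈I , Equivalence.to (Admissible-above (apex-above i i∈I) (I≤n i i∈I)) p
    from : Admitted n (suc k) I G → K G ≡ true
    from (i , i∈I , p) =
      Equivalence.from (χ G) (i , i∈I , Equivalence.from (Admissible-above (apex-above i i∈I) (I≤n i i∈I)) p)

  characterisation-F∈K : (I : Vec Bool m) → ApexBound n I → (K : Complex m) → Characterises n k I K
    → Characterises n (suc k) I (λ G → (K G ∧ not (F ⊆ᵇ G)) ∨ joinStar K (vface k) F G)
  characterisation-F∈K I I≤n K χ G = mk⇔ to from
    where
    kept : Bool
    kept = K G ∧ not (F ⊆ᵇ G)
    to : (kept ∨ joinStar K (vface k) F G) ≡ true → Admitted n (suc k) I G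
    to e with ∨-true⁻ kept e
    ... | inj₁ G-kept with ∧-true⁻ (K G) G-kept
    ...   | G∈K , F⊈G with Equivalence.to (χ G) G∈K
    ...     | i , i∈I , p = i , i∈I , Admissible-keep p (not-⊆ᵇ⇒⊈ F G F⊈G ∘ Covers⇒F⊆ G)
    to e | inj₂ G-joined with ∧-true⁻ (not (F ⊆ᵇ (G ∩F F))) G-joined
    ...   | F⊈G∩F , link with Equivalence.to (χ (cone G)) (proj₂ (∧-true⁻ (disjointᵇ (G ∖F (vface k ∪F F)) F) link))
    ...     | i , i∈I , p = i , i∈I , Admissible-uncone (I≤n i i∈I) p
                                        (not-⊆ᵇ⇒⊈ F (G ∩F F) F⊈G∩F ∘ ⊆⇒⊆∩F F G ∘ Covers⇒F⊆ G)
    from : Admitted n (suc k) I G → (kept ∨ joinStar K (vface k) F G) ≡ true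
    from (i , i∈I , p) with k <? i | G ∋ nv k in vk∈G
    ... | yes k<i | _ = ∨-trueˡ _ (∧-true
            (Equivalence.from (χ G) (i , i∈I , Equivalence.from (Admissible-above k<i (I≤n i i∈I)) p))
            (⊈⇒not-⊆ᵇ F G (Admissible⇒F⊈ p)))
    ... | no k≮i | false = ∨-trueˡ _ (∧-true (Equivalence.from (χ G) (i , i∈I , Admissible-drop p vk∈G))
                                              (⊈⇒not-⊆ᵇ F G (Admissible⇒F⊈ p)))
    ... | no k≮i | true = ∨-trueʳ kept (∧-true
            (⊈⇒not-⊆ᵇ F (G ∩F F) (Admissible⇒F⊈ p ∘ ⊆∩F⇒⊆ F G))
            (∧-true (disjointᵇ-∖∪ G (vface k) F)
                    (Equivalence.from (χ (cone G)) (i , i∈I , Admissible-cone p (≮⇒≥ k≮i) vk∈G))))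

  step-characterisation : (I : Vec Bool m) → ApexBound n I → (K : Complex m)
    → Characterises n k I K → Characterises n (suc k) I (step n k K)
  step-characterisation I I≤n K χ with K F in F∈K
  ... | false = characterisation-F∉K I I≤n K χ F∈K
  ... | true  = characterisation-F∈K I I≤n K χ

steps-characterisation : ∀ {m} n (I : Vec Bool m) → suc (suc n) ≤ m → ApexBound n I
  → ∀ r k (K : Complex m) → k + r ≤ suc n → Characterises n k I K → Characterises n (k + r) I (steps n k r K)
steps-characterisation n I n+2≤m I≤n zero k K _ χ =
  subst (λ j → Characterises n j I K) (sym (+-identityʳ k)) χ
steps-characterisation n I n+2≤m I≤n (suc r) k K k+r+1≤n+1 χ =
  subst (λ j → Characterises n j I (steps n (suc k) r (step n k K))) (sym (+-suc k r))
    (steps-characterisation n I n+2≤m I≤n r (suc k) (step n k K) (subst (_≤ suc n) (+-suc k r) k+r+1≤n+1)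
      (Step.step-characterisation n k n+2≤m k≤n I I≤n K χ))
  where
  k≤n : k ≤ n
  k≤n = s≤s⁻¹ (≤-trans (s≤s (m≤m+n k r)) (subst (_≤ suc n) (+-suc k r) k+r+1≤n+1))

◇-characterisation : ∀ {m} n (I : Vec Bool m) → suc (suc n) ≤ m → ApexBound n I
  → Characterises n (suc n) I (◇ n (Γ n I))
◇-characterisation n I n+2≤m I≤n =
  steps-characterisation n I n+2≤m I≤n (suc n) 0 (Γ n I) ≤-refl (Γ-characterisation n I n+2≤m I≤n)

Supported : ∀ {m} → ℕ → Face m → Set
Supported d G = ∀ x → G ∋ x ≡ true → index x ≤ d

Supported⇒¬Covers : ∀ {m d} {G : Face m} → Supported d G → ¬ Covers d (suc d) G
Supported⇒¬Covers {d = d} supp covers = 1+n≰n (supp (o (suc d)) (covers (suc d) ≤-refl ≤-refl))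

Admissible⇒Supported : ∀ {m n i} {G : Face m} → Admissible n (suc n) i G → Supported n G
Admissible⇒Supported {n = n} {G = G} p (o a) a∈G =
  s≤s⁻¹ (≤∧≢⇒< (orig≤ p a a∈G) λ { refl → ¬covers p λ b n+1≤b b≤n+1 →
    subst (λ c → G ∋ o c ≡ true) (≤-antisym n+1≤b b≤n+1) a∈G })
Admissible⇒Supported p (nv a) a∈G = s≤s⁻¹ (proj₂ (new∈ p a a∈G))

Admissible-suc⇔ : ∀ {m n i} {G : Face m}
  → Admissible n (suc n) i G ⇔ (Admissible (suc n) (suc (suc n)) i G × G ∋ o (suc n) ≡ false × G ∋ nv (suc n) ≡ false)
Admissible-suc⇔ {n = n} {i} {G} = mk⇔ to from
  where
  to : Admissible n (suc n) i G → Admissible (suc n) (suc (suc n)) i G × G ∋ o (suc n) ≡ false × G ∋ nv (suc n) ≡ false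
  to p = record
    { apex∉   = apex∉ p
    ; orig≤   = λ a a∈G → m≤n⇒m≤1+n (orig≤ p a a∈G)
    ; new∈    = λ a a∈G → proj₁ (new∈ p a a∈G) , m<n⇒m<1+n (proj₂ (new∈ p a a∈G))
    ; ¬pair   = λ a i<a _ oa na → ¬pair p a i<a (proj₂ (new∈ p a na)) oa na
    ; ¬covers = Supported⇒¬Covers (λ x x∈G → m≤n⇒m≤1+n (Admissible⇒Supported p x x∈G))
    }
    , ¬-not (λ n+1∈G → 1+n≰n (Admissible⇒Supported p (o (suc n)) n+1∈G))
    , ¬-not (λ n+1∈G → 1+n≰n (Admissible⇒Supported p (nv (suc n)) n+1∈G))
  from : Admissible (suc n) (suc (suc n)) i G × G ∋ o (suc n) ≡ false × G ∋ nv (suc n) ≡ false → Admissible n (suc n) i G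
  from (p , n+1∉G , vn+1∉G) = record
    { apex∉   = apex∉ p
    ; orig≤   = λ a a∈G → Admissible⇒Supported p (o a) a∈G
    ; new∈    = λ a a∈G → proj₁ (new∈ p a a∈G)
                        , ≤∧≢⇒< (s≤s⁻¹ (proj₂ (new∈ p a a∈G))) λ { refl → not-¬ a∈G vn+1∉G }
    ; ¬pair   = λ a i<a a≤n → ¬pair p a i<a (m<n⇒m<1+n a≤n)
    ; ¬covers = λ covers → not-¬ (covers (suc n) ≤-refl ≤-refl) n+1∉G
    }

Image : ∀ {m} → (Vx → Vx) → Face m → Face m → Set
Image f F G = (∀ x → F ∋ x ≡ true → G ∋ f x ≡ true)
            × (∀ y → G ∋ y ≡ true → Σ Vx λ x → F ∋ x ≡ true × f x ≡ y)

IsImage⇔Image : ∀ {m} (f : Vx → Vx) (F G : Face m) → IsImage f F G ⇔ Image f F G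
IsImage⇔Image f F G = mk⇔ to from
  where
  to : IsImage f F G → Image f F G
  to (fw , bw) = fw′ , bw′
    where
    fw′ : ∀ x → F ∋ x ≡ true → G ∋ f x ≡ true
    fw′ x x∈F with fw _ (∋⇒∈F F x x∈F)
    ... | w , w∈G , fv≡w = subst (λ y → G ∋ y ≡ true)
                             (sym (trans (cong f (sym (⌜vertex⌝ x _))) fv≡w)) (∈F⇒∋ w G w∈G)
    bw′ : ∀ y → G ∋ y ≡ true → Σ Vx λ x → F ∋ x ≡ true × f x ≡ y
    bw′ y y∈G with bw _ (∋⇒∈F G y y∈G)
    ... | v , v∈F , fv≡w = ⌜ v ⌝ , ∈F⇒∋ v F v∈F , trans fv≡w (⌜vertex⌝ y _)
  from : Image f F G → IsImage f F G
  from (fw , bw) = fw′ , bw′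
    where
    fw′ : (v : V _) → v ∈F F → Σ (V _) λ w → w ∈F G × (f ⌜ v ⌝ ≡ ⌜ w ⌝)
    fw′ v v∈F = _ , ∋⇒∈F G (f ⌜ v ⌝) fv∈G , sym (⌜vertex⌝ (f ⌜ v ⌝) _)
      where
      fv∈G : G ∋ f ⌜ v ⌝ ≡ true
      fv∈G = fw ⌜ v ⌝ (∈F⇒∋ v F v∈F)
    bw′ : (w : V _) → w ∈F G → Σ (V _) λ v → v ∈F F × (f ⌜ v ⌝ ≡ ⌜ w ⌝)
    bw′ w w∈G with bw ⌜ w ⌝ (∈F⇒∋ w G w∈G)
    ... | x , x∈F , fx≡w = _ , ∋⇒∈F F x x∈F , trans (cong f (⌜vertex⌝ x _)) fx≡w

Image-involution : ∀ {m} (g f : Vx → Vx) (F G H : Face m) → (∀ y → g (g y) ≡ y)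
  → (∀ y → H ∋ y ≡ G ∋ g y) → Image (λ x → g (f x)) F G ⇔ Image f F H
Image-involution g f F G H g-involutive H∋ = mk⇔
  (λ (fw , bw) → (λ x x∈F → trans (H∋ (f x)) (fw x x∈F))
               , λ y y∈H → let (x , x∈F , gfx≡gy) = bw (g y) (trans (sym (H∋ y)) y∈H)
                           in x , x∈F , trans (sym (g-involutive (f x))) (trans (cong g gfx≡gy) (g-involutive y)))
  (λ (fw , bw) → (λ x x∈F → trans (sym (H∋ (f x))) (fw x x∈F))
               , λ y y∈G → let (x , x∈F , fx≡gy) = bw (g y) (trans (H∋ (g y)) (trans (cong (G ∋_) (g-involutive y)) y∈G))
                           in x , x∈F , trans (cong g fx≡gy) (g-involutive y))

ρℕ-zero : ∀ d → (0 + d) % suc d ≡ d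
ρℕ-zero d = m≤n⇒m%n≡m ≤-refl

ρℕ-suc : ∀ d b → b < d → (suc b + d) % suc d ≡ b
ρℕ-suc d b b<d = begin
  (suc b + d) % suc d   ≡⟨ cong (_% suc d) (sym (+-suc b d)) ⟩
  (b + suc d) % suc d   ≡⟨ [m+n]%n≡m%n b (suc d) ⟩
  b % suc d             ≡⟨ m≤n⇒m%n≡m (<⇒≤ b<d) ⟩
  b                     ∎
  where open ≡-Reasoning

ρ-index≤ : ∀ d x → index (ρ d x) ≤ d
ρ-index≤ d (o a)  = s≤s⁻¹ (m%n<n (a + d) (suc d))
ρ-index≤ d (nv a) = s≤s⁻¹ (m%n<n (a + d) (suc d))

ρℕ-injective : ∀ d a b → a ≤ d → b ≤ d → (a + d) % suc d ≡ (b + d) % suc d → a ≡ b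
ρℕ-injective d zero    zero    _   _   _ = refl
ρℕ-injective d zero    (suc b) _   b<d e = ⊥-elim (<-irrefl (trans (sym (ρℕ-suc d b b<d)) (trans (sym e) (ρℕ-zero d))) b<d)
ρℕ-injective d (suc a) zero    a<d _   e = ⊥-elim (<-irrefl (trans (sym (ρℕ-suc d a a<d)) (trans e (ρℕ-zero d))) a<d)
ρℕ-injective d (suc a) (suc b) a<d b<d e = cong suc (trans (sym (ρℕ-suc d a a<d)) (trans e (ρℕ-suc d b b<d)))

o-injective : ∀ {a b} → o a ≡ o b → a ≡ b
o-injective refl = refl

nv-injective : ∀ {a b} → nv a ≡ nv b → a ≡ b
nv-injective refl = refl

ρ-injective : ∀ d x y → index x ≤ d → index y ≤ d → ρ d x ≡ ρ d y → x ≡ y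
ρ-injective d (o a)  (o b)  a≤d b≤d e = cong o  (ρℕ-injective d a b a≤d b≤d (o-injective e))
ρ-injective d (nv a) (nv b) a≤d b≤d e = cong nv (ρℕ-injective d a b a≤d b≤d (nv-injective e))

ρℕ-surjective : ∀ d b → b ≤ d → Σ ℕ λ a → a ≤ d × (a + d) % suc d ≡ b
ρℕ-surjective d b b≤d with m≤n⇒m<n∨m≡n b≤d
... | inj₁ b<d  = suc b , b<d , ρℕ-suc d b b<d
... | inj₂ refl = zero , z≤n , ρℕ-zero d

ρ-surjective : ∀ d y → index y ≤ d → Σ Vx λ x → index x ≤ d × ρ d x ≡ y
ρ-surjective d (o b) b≤d with ρℕ-surjective d b b≤d
... | a , a≤d , e = o a , a≤d , cong o e
ρ-surjective d (nv b) b≤d with ρℕ-surjective d b b≤d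
... | a , a≤d , e = nv a , a≤d , cong nv e

Image-ρ : ∀ {m} d (F G : Face m) → Supported d F
  → Image (ρ d) F G ⇔ (Supported d G × (∀ x → index x ≤ d → F ∋ x ≡ G ∋ ρ d x))
Image-ρ d F G F-supp = mk⇔
  (λ (fw , bw) →
      (λ y y∈G → let (x , _ , ρx≡y) = bw y y∈G in subst (λ z → index z ≤ d) ρx≡y (ρ-index≤ d x))
    , λ x x≤d → ≡true-ext (fw x) λ ρx∈G →
        let (x′ , x′∈F , ρx′≡ρx) = bw (ρ d x) ρx∈G
        in subst (λ z → F ∋ z ≡ true) (ρ-injective d x′ x (F-supp x′ x′∈F) x≤d ρx′≡ρx) x′∈F)
  (λ (G-supp , rotated) →
      (λ x x∈F → trans (sym (rotated x (F-supp x x∈F))) x∈F)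
    , λ y y∈G → let (x , x≤d , ρx≡y) = ρ-surjective d y (G-supp y y∈G)
                in x , trans (rotated x x≤d) (trans (cong (G ∋_) ρx≡y) y∈G) , ρx≡y)

-- ρ lowers the apex i + 1 of F to the apex i of G; the vertex v₀, which F cannot contain, becomes v_d.
module Rotation {m : ℕ} (d i : ℕ) (i<d : i < d) (F G : Face m)
                (F-supp : Supported d F) (G-supp : Supported d G)
                (rotated : ∀ x → index x ≤ d → F ∋ x ≡ G ∋ ρ d x) where

  F-o-suc : ∀ b → b < d → F ∋ o (suc b) ≡ G ∋ o b
  F-o-suc b b<d = trans (rotated (o (suc b)) b<d) (cong (λ c → G ∋ o c) (ρℕ-suc d b b<d))

  F-nv-suc : ∀ b → b < d → F ∋ nv (suc b) ≡ G ∋ nv b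
  F-nv-suc b b<d = trans (rotated (nv (suc b)) b<d) (cong (λ c → G ∋ nv c) (ρℕ-suc d b b<d))

  F-nv-zero : F ∋ nv 0 ≡ G ∋ nv d
  F-nv-zero = trans (rotated (nv 0) z≤n) (cong (λ c → G ∋ nv c) (ρℕ-zero d))

  G-new<d : ∀ a → G ∋ nv a ≡ true → G ∋ nv d ≡ false → a < d
  G-new<d a a∈G vd∉G = ≤∧≢⇒< (G-supp (nv a) a∈G) λ { refl → not-¬ a∈G vd∉G }

  rotate : Admissible d (suc d) (suc i) F → Admissible d (suc d) i G × G ∋ nv d ≡ false
  rotate p = record
    { apex∉   = trans (sym (F-o-suc i i<d)) (apex∉ p)
    ; orig≤   = λ a a∈G → m≤n⇒m≤1+n (G-supp (o a) a∈G)
    ; new∈    = λ a a∈G → let a<d = G-new<d a a∈G vd∉G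
                          in s≤s⁻¹ (proj₁ (new∈ p (suc a) (trans (F-nv-suc a a<d) a∈G))) , m<n⇒m<1+n a<d
    ; ¬pair   = λ a i<a _ oa na → let a<d = G-new<d a na vd∉G
                                  in ¬pair p (suc a) (s≤s i<a) (s≤s a<d)
                                       (trans (F-o-suc a a<d) oa) (trans (F-nv-suc a a<d) na)
    ; ¬covers = Supported⇒¬Covers G-supp
    } , vd∉G
    where
    vd∉G : G ∋ nv d ≡ false
    vd∉G = ¬-not λ vd∈G → <⇒≱ (s≤s z≤n) (proj₁ (new∈ p 0 (trans F-nv-zero vd∈G)))

  unrotate : Admissible d (suc d) i G → G ∋ nv d ≡ false → Admissible d (suc d) (suc i) F
  unrotate q vd∉G = record
    { apex∉   = trans (F-o-suc i i<d) (apex∉ q)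
    ; orig≤   = λ a a∈F → m≤n⇒m≤1+n (F-supp (o a) a∈F)
    ; new∈    = new∈′
    ; ¬pair   = ¬pair′
    ; ¬covers = Supported⇒¬Covers F-supp
    }
    where
    new∈′ : ∀ a → F ∋ nv a ≡ true → suc i ≤ a × a < suc d
    new∈′ zero    v₀∈F = ⊥-elim (not-¬ (trans (sym F-nv-zero) v₀∈F) vd∉G)
    new∈′ (suc b) a∈F  = s≤s (proj₁ (new∈ q b (trans (sym (F-nv-suc b b<d)) a∈F))) , s≤s b<d
      where
      b<d : b < d
      b<d = F-supp (nv (suc b)) a∈F
    ¬pair′ : ∀ a → suc i < a → a < suc d → F ∋ o a ≡ true → F ∋ nv a ≡ true → ⊥
    ¬pair′ (suc b) (s≤s i<b) (s≤s b<d) oa na =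
      ¬pair q b i<b (m<n⇒m<1+n b<d) (trans (sym (F-o-suc b b<d)) oa) (trans (sym (F-nv-suc b b<d)) na)

ψ-o : ∀ d a → a ≢ d → ψ d (o a) ≡ o a
ψ-o d a a≢d rewrite ≡ᵇ-false a≢d = refl

ψ-nv : ∀ d a → a ≢ d → ψ d (nv a) ≡ nv a
ψ-nv d a a≢d rewrite ≡ᵇ-false a≢d = refl

ψ-o-d : ∀ d → ψ d (o d) ≡ nv d
ψ-o-d d rewrite ≡ᵇ-true {d} refl = refl

ψ-nv-d : ∀ d → ψ d (nv d) ≡ o d
ψ-nv-d d rewrite ≡ᵇ-true {d} refl = refl

ψ-involutive : ∀ d x → ψ d (ψ d x) ≡ x
ψ-involutive d (o a) with a ≟ d
... | yes refl = trans (cong (ψ d) (ψ-o-d d)) (ψ-nv-d d)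
... | no  a≢d  = trans (cong (ψ d) (ψ-o d a a≢d)) (ψ-o d a a≢d)
ψ-involutive d (nv a) with a ≟ d
... | yes refl = trans (cong (ψ d) (ψ-nv-d d)) (ψ-o-d d)
... | no  a≢d  = trans (cong (ψ d) (ψ-nv d a a≢d)) (ψ-nv d a a≢d)

ψ-index : ∀ d x → index (ψ d x) ≡ index x
ψ-index d (o a) with a ≟ d
... | yes refl = cong index (ψ-o-d d)
... | no  a≢d  = cong index (ψ-o d a a≢d)
ψ-index d (nv a) with a ≟ d
... | yes refl = cong index (ψ-nv-d d)
... | no  a≢d  = cong index (ψ-nv d a a≢d)

swap : ∀ {m} → ℕ → Face m → Face m
swap d G = faceOf (λ y → G ∋ ψ d y)

swap-∋ : ∀ {m} d (G : Face m) y → swap d G ∋ y ≡ G ∋ ψ d y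
swap-∋ d G = faceOf-∋ _ λ y m≤y → ∋-outside G (ψ d y) (subst (_ ≤_) (sym (ψ-index d y)) m≤y)

Admissible-swap : ∀ {m} d i (G H : Face m) → i < d → (∀ y → H ∋ y ≡ G ∋ ψ d y)
  → Admissible d (suc d) i G → Admissible d (suc d) i H
Admissible-swap d i G H i<d H∋ q = record
  { apex∉   = trans (H-o i (<⇒≢ i<d)) (apex∉ q)
  ; orig≤   = orig≤′
  ; new∈    = new∈′
  ; ¬pair   = ¬pair′
  ; ¬covers = λ covers → ¬covers q λ a d<a a≤d+1 → trans (sym (H-o a (>⇒≢ d<a))) (covers a d<a a≤d+1)
  }
  where
  H-o : ∀ a → a ≢ d → H ∋ o a ≡ G ∋ o a
  H-o a a≢d = trans (H∋ (o a)) (cong (G ∋_) (ψ-o d a a≢d))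
  H-nv : ∀ a → a ≢ d → H ∋ nv a ≡ G ∋ nv a
  H-nv a a≢d = trans (H∋ (nv a)) (cong (G ∋_) (ψ-nv d a a≢d))
  orig≤′ : ∀ a → H ∋ o a ≡ true → a ≤ suc d
  orig≤′ a a∈H with a ≟ d
  ... | yes refl = n≤1+n d
  ... | no  a≢d  = orig≤ q a (trans (sym (H-o a a≢d)) a∈H)
  new∈′ : ∀ a → H ∋ nv a ≡ true → i ≤ a × a < suc d
  new∈′ a a∈H with a ≟ d
  ... | yes refl = <⇒≤ i<d , ≤-refl
  ... | no  a≢d  = new∈ q a (trans (sym (H-nv a a≢d)) a∈H)
  ¬pair′ : ∀ a → i < a → a < suc d → H ∋ o a ≡ true → H ∋ nv a ≡ true → ⊥
  ¬pair′ a i<a a≤d oa na with a ≟ d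
  ... | yes refl = ¬pair q d i<d ≤-refl (trans (sym (trans (H∋ (nv d)) (cong (G ∋_) (ψ-nv-d d)))) na)
                                        (trans (sym (trans (H∋ (o d)) (cong (G ∋_) (ψ-o-d d)))) oa)
  ... | no  a≢d  = ¬pair q a i<a a≤d (trans (sym (H-o a a≢d)) oa) (trans (sym (H-nv a a≢d)) na)

lookupℕ-tabulate : ∀ {m} (f : Fin m → Bool) {a} (a<m : a < m) → lookupℕ (tabulate f) a ≡ f (fromℕ< a<m)
lookupℕ-tabulate f a<m = trans (sym (lookupℕ-fromℕ< (tabulate f) a<m)) (lookup∘tabulate f _)

shift-true⁻ : ∀ {m} (I : Vec Bool m) a → lookupℕ (shift I) a ≡ true → Σ ℕ λ i → a ≡ suc i × lookupℕ I i ≡ true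
shift-true⁻ I a a∈I+1 = predecessor (anyFin-true⁻ _ (trans (sym (lookupℕ-tabulate _ a<m)) a∈I+1))
  where
  a<m : a < _
  a<m = lookupℕ-true⇒< (shift I) a∈I+1
  predecessor : Σ (Fin _) (λ j → (lookup I j ∧ (suc (toℕ j) ≡ᵇ toℕ (fromℕ< a<m))) ≡ true)
    → Σ ℕ λ i → a ≡ suc i × lookupℕ I i ≡ true
  predecessor (j , found) with ∧-true⁻ (lookup I j) found
  ... | j∈I , j+1≡a = toℕ j , sym (trans (≡ᵇ-true⁻ j+1≡a) (toℕ-fromℕ< a<m)) , trans (lookupℕ-toℕ I j) j∈I

shift-true : ∀ {m} (I : Vec Bool m) i → suc i < m → lookupℕ I i ≡ true → lookupℕ (shift I) (suc i) ≡ true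
shift-true I i i+1<m i∈I = trans (lookupℕ-tabulate _ i+1<m)
  (anyFin-true _ (fromℕ< i<m) (∧-true (trans (lookupℕ-fromℕ< I i<m) i∈I)
    (≡ᵇ-true (trans (cong suc (toℕ-fromℕ< i<m)) (sym (toℕ-fromℕ< i+1<m))))))
  where
  i<m : i < _
  i<m = <-trans (n<1+n i) i+1<m

Img-⇔ : ∀ {m} (f g : Vx → Vx) (K : Complex m) (G H : Face m)
  → (∀ F → IsImage f F G ⇔ IsImage g F H) → Img f K G ⇔ Img g K H
Img-⇔ f g K G H image⇔ = mk⇔ (λ (F , F∈K , img) → F , F∈K , Equivalence.to (image⇔ F) img)
                              (λ (F , F∈K , img) → F , F∈K , Equivalence.from (image⇔ F) img)

singleton-∋ : ∀ {m} x (x<m : index x < m) → singleton (vertex x x<m) ∋ x ≡ true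
singleton-∋ x x<m = subst (λ y → singleton v ∋ y ≡ true) (⌜vertex⌝ x x<m) (∈F⇒∋ v _ (singleton-self v))
  where
  v : V _
  v = vertex x x<m

excluded-vertex-induced : ∀ {m} (L : Face m → Set) (K : Complex m) x
  → (∀ G → L G ⇔ (K G ≡ true × G ∋ x ≡ false)) → IsInducedSub L K
excluded-vertex-induced L K x L⇔ =
    (λ G l → proj₁ (Equivalence.to (L⇔ G) l))
  , λ G G∈K vertices-in-L → Equivalence.from (L⇔ G) (G∈K , ¬-not λ x∈G →
      not-¬ (singleton-∋ x _) (proj₂ (Equivalence.to (L⇔ _) (vertices-in-L _ (∋⇒∈F G x x∈G)))))

shift-ApexBound : ∀ {m} n (I : Vec Bool m) → ApexBound n I → ApexBound (suc n) (shift I)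
shift-ApexBound n I I≤n a a∈I+1 with shift-true⁻ I a a∈I+1
... | i , refl , i∈I = s≤s (I≤n i i∈I)

module Decomposition (e : ℕ) (I : Vec Bool (suc (suc (suc e)))) (I≤e : ApexBound e I)
                 (E D D′ : Complex (suc (suc (suc e))))
                 (χE : Characterises (suc e) (suc (suc e)) (shift I) E)
                 (χD : Characterises (suc e) (suc (suc e)) I D)
                 (χD′ : Characterises e (suc e) I D′) where

  d : ℕ
  d = suc e

  I<d : ∀ i → lookupℕ I i ≡ true → i < d
  I<d i i∈I = s≤s (I≤e i i∈I)

  ρ-preimage : Face (suc (suc d)) → Face (suc (suc d))
  ρ-preimage G = faceOf (λ x → (index x ≤ᵇ d) ∧ G ∋ ρ d x)

  ρ-preimage-∋ : ∀ G x → ρ-preimage G ∋ x ≡ ((index x ≤ᵇ d) ∧ G ∋ ρ d x)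
  ρ-preimage-∋ G = faceOf-∋ _ λ x m≤x → cong (_∧ G ∋ ρ d x) (≤ᵇ-false (≤-trans (n≤1+n _) m≤x))

  ρ-image⇔ : ∀ G → Img (ρ d) E G ⇔ (Admitted d (suc d) I G × G ∋ nv d ≡ false)
  ρ-image⇔ G = mk⇔ to from
    where
    to : Img (ρ d) E G → Admitted d (suc d) I G × G ∋ nv d ≡ false
    to (F , F∈E , img) with Equivalence.to (χE F) F∈E
    ... | a , a∈I+1 , p with shift-true⁻ I a a∈I+1
    ...   | i , refl , i∈I =
      let F-supp              = Admissible⇒Supported p
          (G-supp , rotated)  = Equivalence.to (Image-ρ d F G F-supp) (Equivalence.to (IsImage⇔Image (ρ d) F G) img)
          (q , vd∉G)          = Rotation.rotate d i (I<d i i∈I) F G F-supp G-supp rotated p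
      in (i , i∈I , q) , vd∉G
    from : Admitted d (suc d) I G × G ∋ nv d ≡ false → Img (ρ d) E G
    from ((i , i∈I , q) , vd∉G) = F , F∈E , Equivalence.from (IsImage⇔Image (ρ d) F G)
                                           (Equivalence.from (Image-ρ d F G F-supp) (G-supp , rotated))
      where
      F : Face (suc (suc d))
      F = ρ-preimage G
      F-supp : Supported d F
      F-supp x x∈F = ≤ᵇ-true⁻ (proj₁ (∧-true⁻ _ (trans (sym (ρ-preimage-∋ G x)) x∈F)))
      G-supp : Supported d G
      G-supp = Admissible⇒Supported q
      rotated : ∀ x → index x ≤ d → F ∋ x ≡ G ∋ ρ d x
      rotated x x≤d = trans (ρ-preimage-∋ G x) (cong (_∧ G ∋ ρ d x) (≤ᵇ-true x≤d))
      F∈E : E F ≡ true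
      F∈E = Equivalence.from (χE F)
        ( suc i , shift-true I i (s≤s (s≤s (m≤n⇒m≤1+n (I≤e i i∈I)))) i∈I
        , Rotation.unrotate d i (I<d i i∈I) F G F-supp G-supp rotated q vd∉G)

  -- σ = ψ ∘ ρ with ψ an involution, so σ[F] = G exactly when ρ[F] is the swap of G.
  σ-image⇔ : ∀ G → Img (σ d) E G ⇔ (Admitted d (suc d) I G × G ∋ o d ≡ false)
  σ-image⇔ G = mk⇔
    (λ s → let ((i , i∈I , q) , vd∉swap) = Equivalence.to (ρ-image⇔ (swap d G)) (Equivalence.to σ⇔ρ s)
           in (i , i∈I , Admissible-swap d i (swap d G) G (I<d i i∈I) unswap q)
            , trans (sym (trans (swap-∋ d G (nv d)) (cong (G ∋_) (ψ-nv-d d)))) vd∉swap)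
    (λ ((i , i∈I , q) , d∉G) → Equivalence.from σ⇔ρ (Equivalence.from (ρ-image⇔ (swap d G))
            ( (i , i∈I , Admissible-swap d i G (swap d G) (I<d i i∈I) (swap-∋ d G) q)
            , trans (swap-∋ d G (nv d)) (trans (cong (G ∋_) (ψ-nv-d d)) d∉G))))
    where
    σ⇔ρ : Img (σ d) E G ⇔ Img (ρ d) E (swap d G)
    σ⇔ρ = Img-⇔ (σ d) (ρ d) E G (swap d G) λ F →
      ⇔-sym (IsImage⇔Image (ρ d) F (swap d G))
        ⇔-∘ (Image-involution (ψ d) (ρ d) F G (swap d G) (ψ-involutive d) (swap-∋ d G)
        ⇔-∘ IsImage⇔Image (σ d) F G)
    unswap : ∀ y → G ∋ y ≡ swap d G ∋ ψ d y
    unswap y = trans (cong (G ∋_) (sym (ψ-involutive d y))) (sym (swap-∋ d G (ψ d y)))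

  image-union : ∀ G → D G ≡ true ⇔ (Img (ρ d) E G ⊎ Img (σ d) E G)
  image-union G = mk⇔ to from
    where
    to : D G ≡ true → Img (ρ d) E G ⊎ Img (σ d) E G
    to G∈D with Equivalence.to (χD G) G∈D | G ∋ nv d in vd∈G
    ... | admitted | false = inj₁ (Equivalence.from (ρ-image⇔ G) (admitted , vd∈G))
    ... | i , i∈I , q | true = inj₂ (Equivalence.from (σ-image⇔ G) ((i , i∈I , q) , d∉G))
      where
      d∉G : G ∋ o d ≡ false
      d∉G = ¬-not λ d∈G → ¬pair q d (I<d i i∈I) ≤-refl d∈G vd∈G
    from : Img (ρ d) E G ⊎ Img (σ d) E G → D G ≡ true
    from = [ (λ r → Equivalence.from (χD G) (proj₁ (Equivalence.to (ρ-image⇔ G) r)))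
           , (λ s → Equivalence.from (χD G) (proj₁ (Equivalence.to (σ-image⇔ G) s))) ]′

  image-intersection : ∀ G → (Img (ρ d) E G × Img (σ d) E G) ⇔ (D′ G ≡ true)
  image-intersection G = mk⇔
    (λ (r , s) → let ((i , i∈I , q) , vd∉G) = Equivalence.to (ρ-image⇔ G) r
                     (_ , d∉G)              = Equivalence.to (σ-image⇔ G) s
                 in Equivalence.from (χD′ G) (i , i∈I , Equivalence.from Admissible-suc⇔ (q , d∉G , vd∉G)))
    (λ G∈D′ → let (i , i∈I , p)       = Equivalence.to (χD′ G) G∈D′
                  (q , d∉G , vd∉G)    = Equivalence.to Admissible-suc⇔ p
              in Equivalence.from (ρ-image⇔ G) ((i , i∈I , q) , vd∉G)
               , Equivalence.from (σ-image⇔ G) ((i , i∈I , q) , d∉G))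

  ρ-induced : IsInducedSub (Img (ρ d) E) D
  ρ-induced = excluded-vertex-induced (Img (ρ d) E) D (nv d) λ G → mk⇔
    (λ r → let (admitted , vd∉G) = Equivalence.to (ρ-image⇔ G) r in Equivalence.from (χD G) admitted , vd∉G)
    (λ (G∈D , vd∉G) → Equivalence.from (ρ-image⇔ G) (Equivalence.to (χD G) G∈D , vd∉G))

  σ-induced : IsInducedSub (Img (σ d) E) D
  σ-induced = excluded-vertex-induced (Img (σ d) E) D (o d) λ G → mk⇔
    (λ s → let (admitted , d∉G) = Equivalence.to (σ-image⇔ G) s in Equivalence.from (χD G) admitted , d∉G)
    (λ (G∈D , d∉G) → Equivalence.from (σ-image⇔ G) (Equivalence.to (χD G) G∈D , d∉G))

corollary4p10 : (d : ℕ) → 1 ≤ d → (I : Vec Bool (suc (suc d)))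
    → (∀ i → lookup I i ≡ true → toℕ i ≤ d)
    → (∀ i → lookup I i ≡ true → toℕ i ≢ d)
    → (∀ G → (◇ d (Γ d I) G ≡ true)
               ⇔ (Img (ρ d) (◇ d (Γ d (shift I))) G ⊎ Img (σ d) (◇ d (Γ d (shift I))) G))
      × (∀ G → (Img (ρ d) (◇ d (Γ d (shift I))) G × Img (σ d) (◇ d (Γ d (shift I))) G)
               ⇔ (◇ (d ∸ 1) (Γ (d ∸ 1) I) G ≡ true))
      × IsInducedSub (Img (ρ d) (◇ d (Γ d (shift I)))) (◇ d (Γ d I))
      × IsInducedSub (Img (σ d) (◇ d (Γ d (shift I)))) (◇ d (Γ d I))
corollary4p10 zero () I
corollary4p10 (suc e) _ I I≤d I≢d = image-union , image-intersection , ρ-induced , σ-induced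
  where
  I≤e : ApexBound e I
  I≤e i i∈I = s≤s⁻¹ (subst (_< suc e) (toℕ-fromℕ< i<m) (≤∧≢⇒< (I≤d j j∈I) (I≢d j j∈I)))
    where
    i<m : i < suc (suc (suc e))
    i<m = lookupℕ-true⇒< I i∈I
    j : Fin (suc (suc (suc e)))
    j = fromℕ< i<m
    j∈I : lookup I j ≡ true
    j∈I = trans (lookupℕ-fromℕ< I i<m) i∈I
  open Decomposition e I I≤e _ _ _
    (◇-characterisation (suc e) (shift I) ≤-refl (shift-ApexBound e I I≤e))
    (◇-characterisation (suc e) I ≤-refl λ i i∈I → m≤n⇒m≤1+n (I≤e i i∈I))
    (◇-characterisation e I (n≤1+n _) I≤e)
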